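{- Suppose that $\mathcal{V}$ is a rainbow Ramsey ultrafilter on $\omega$, $k\in\omega$, and $\chi:[\omega]^2\rightarrow\omega$ is a $k$-bounded coloring. Then there is $A\in\mathcal{V}$ which is polychromatic for $\chi$.
   Context: A coloring $\chi:[\omega]^2\rightarrow\omega$ is $k$-bounded if each color is assigned to at most $k$ pairs. A set $A$ is polychromatic for $\chi$ if distinct pairs from $A$ receive distinct colors. A nonprincipal ultrafilter $\mathcal{V}$ on $\omega$ is rainbow Ramsey if for every $2$-bounded coloring $\chi:[\omega]^2\rightarrow\omega$ there is $A\in\mathcal{V}$ polychromatic for $\chi$. -}

module Defs where

open import Data.Nat using (ℕ; _<_; _≤_)
open import Data.Product using (Σ; _×_; _,_; proj₁; proj₂)
open import Data.Sum using (_⊎_)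
open import Data.Empty using (⊥)
open import Data.Unit using (⊤)
open import Data.List using (List; length)
open import Data.List.Relation.Unary.All using (All)
open import Data.List.Relation.Unary.Unique.Propositional using (Unique)
open import Relation.Nullary using (¬_)
open import Relation.Binary.PropositionalEquality using (_≡_)

Subset : Set₁
Subset = ℕ → Set

record NonprincipalUltrafilter (𝒱 : Subset → Set) : Set₁ where
  field
    full       : 𝒱 (λ _ → ⊤)
    proper     : ¬ 𝒱 (λ _ → ⊥)
    upward     : ∀ (A B : Subset) → 𝒱 A → (∀ n → A n → B n) → 𝒱 B
    intersect  : ∀ (A B : Subset) → 𝒱 A → 𝒱 B → 𝒱 (λ n → A n × B n)
    ultra      : ∀ (A : Subset) → 𝒱 A ⊎ 𝒱 (λ n → ¬ A n)
    nonprincipal : ∀ (m : ℕ) → ¬ 𝒱 (λ n → n ≡ m)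

-- A coloring χ : [ω]² → ω is given by χ i j for i < j (values at i ≥ j are irrelevant).
Coloring : Set
Coloring = ℕ → ℕ → ℕ

IsPair : ℕ × ℕ → Set
IsPair p = proj₁ p < proj₂ p

-- χ is k-bounded: each color is assigned to at most k pairs, i.e. every list of
-- distinct pairs all receiving color c has length ≤ k.
Bounded : ℕ → Coloring → Set
Bounded k χ = ∀ (c : ℕ) (ps : List (ℕ × ℕ)) → Unique ps →
  All IsPair ps → All (λ p → χ (proj₁ p) (proj₂ p) ≡ c) ps → length ps ≤ k

Polychromatic : Coloring → Subset → Set
Polychromatic χ A = ∀ i j i' j' → A i → A j → A i' → A j' → i < j → i' < j' →
  χ i j ≡ χ i' j' → (i ≡ i') × (j ≡ j')

record RainbowRamsey (𝒱 : Subset → Set) : Set₁ where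
  field
    ultrafilter : NonprincipalUltrafilter 𝒱
    rainbow     : ∀ (χ : Coloring) → Bounded 2 χ → Σ Subset (λ A → 𝒱 A × Polychromatic χ A)

module Submission where

-- Let χ be k-bounded.  Order [ω]² colexicographically and let
-- rank(i,j) be the number of pairs of colour χ(i,j) preceding (i,j).  Then
-- rank < k, and (χ, rank) is injective on [ω]², because the rank strictly
-- increases along each colour class.  For a, b < k let χ[a,b] be the colouring
-- (i,j) ↦ ⟨χ(i,j), collapse a b (rank(i,j))⟩, where collapse a b sends a and b
-- to 0 and every other n to n + 1, and ⟨_,_⟩ codes pairs injectively.  Each
-- χ[a,b] is 2-bounded: inside one of its colour classes the Boolean
-- "rank ≡ a" determines the pair.  Intersecting the k² sets in 𝒱 that are
-- polychromatic for the χ[a,b] gives A ∈ 𝒱; two pairs of A with equal χ-colour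
-- and ranks a, b get equal χ[a,b]-colour, hence coincide.

open import Defs
open import Data.Nat using (ℕ; zero; suc; _+_; _*_; _<_; _≤_; z≤n; s≤s; _≟_; NonZero)
open import Data.Nat.Properties
open import Data.Nat.DivMod using (_/_; _%_; [m+kn]%n≡m%n; m<n⇒m%n≡m; +-distrib-/-∣ʳ; m<n⇒m/n≡0; m*n/n≡m)
open import Data.Nat.Divisibility using (n∣m*n)
open import Data.Product using (Σ; _×_; _,_; proj₁; proj₂)
open import Data.Sum using (_⊎_; inj₁; inj₂)
open import Data.Bool using (Bool; true; false)
open import Data.List using (List; []; _∷_; _++_; length)
open import Data.List.Properties using (length-++)
open import Data.List.Membership.Propositional using (_∈_)
open import Data.List.Relation.Unary.All as All using (All; []; _∷_)
import Data.List.Relation.Unary.All.Properties as All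
open import Data.List.Relation.Unary.AllPairs using ([]; _∷_)
open import Data.List.Relation.Unary.Unique.Propositional using (Unique)
import Data.List.Relation.Unary.Unique.Propositional.Properties as Unique
open import Relation.Nullary using (¬_; yes; no; contradiction)
open import Relation.Binary using (tri<; tri≈; tri>)
open import Relation.Binary.PropositionalEquality
open import Function using (_∘_)

⋂< : (ℕ → Subset) → ℕ → Subset
⋂< F n x = ∀ m → m < n → F m x

⋂<-∈ : ∀ {𝒱} → NonprincipalUltrafilter 𝒱 →
  ∀ F n → (∀ m → m < n → 𝒱 (F m)) → 𝒱 (⋂< F n)
⋂<-∈ U F zero _ = upward _ _ full (λ _ _ _ ())
  where open NonprincipalUltrafilter U
⋂<-∈ U F (suc n) F∈ =
  upward _ _ (intersect _ _ (⋂<-∈ U F n (λ m m<n → F∈ m (m<n⇒m<1+n m<n))) (F∈ n ≤-refl)) extend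
  where
  open NonprincipalUltrafilter U
  extend : ∀ x → ⋂< F n x × F n x → ⋂< F (suc n) x
  extend x (below , last) m m<1+n with m<1+n⇒m<n∨m≡n m<1+n
  ... | inj₁ m<n = below m m<n
  ... | inj₂ refl = last

three-bools : (x y z : Bool) → x ≡ y ⊎ x ≡ z ⊎ y ≡ z
three-bools false false _     = inj₁ refl
three-bools true  true  _     = inj₁ refl
three-bools false true  false = inj₂ (inj₁ refl)
three-bools false true  true  = inj₂ (inj₂ refl)
three-bools true  false false = inj₂ (inj₂ refl)
three-bools true  false true  = inj₂ (inj₁ refl)

-- If a Boolean tag separates any two distinct pairs of the same ψ-colour, then
-- every ψ-colour class has at most two elements: of three, two share a tag.
tagged⇒2-bounded : (ψ : Coloring) (tag : ℕ → ℕ → Bool) →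
  (∀ i j i' j' → i < j → i' < j' → ψ i j ≡ ψ i' j' → tag i j ≡ tag i' j' → (i , j) ≡ (i' , j')) →
  Bounded 2 ψ
tagged⇒2-bounded ψ tag separates c [] _ _ _ = z≤n
tagged⇒2-bounded ψ tag separates c (_ ∷ []) _ _ _ = s≤s z≤n
tagged⇒2-bounded ψ tag separates c (_ ∷ _ ∷ []) _ _ _ = s≤s (s≤s z≤n)
tagged⇒2-bounded ψ tag separates c ((x₁ , x₂) ∷ (y₁ , y₂) ∷ (z₁ , z₂) ∷ _)
  ((x≢y ∷ x≢z ∷ _) ∷ (y≢z ∷ _) ∷ _) (x-pair ∷ y-pair ∷ z-pair ∷ _) (x-col ∷ y-col ∷ z-col ∷ _)
  with three-bools (tag x₁ x₂) (tag y₁ y₂) (tag z₁ z₂)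
... | inj₁ e        = contradiction (separates _ _ _ _ x-pair y-pair (trans x-col (sym y-col)) e) x≢y
... | inj₂ (inj₁ e) = contradiction (separates _ _ _ _ x-pair z-pair (trans x-col (sym z-col)) e) x≢z
... | inj₂ (inj₂ e) = contradiction (separates _ _ _ _ y-pair z-pair (trans y-col (sym z-col)) e) y≢z

code : (M : ℕ) → ℕ → ℕ → ℕ
code M c x = x + c * M

code-digit : ∀ M .{{_ : NonZero M}} c {x} → x < M → code M c x % M ≡ x
code-digit M c {x} x<M = trans ([m+kn]%n≡m%n x c M) (m<n⇒m%n≡m x<M)

code-quotient : ∀ M .{{_ : NonZero M}} c {x} → x < M → code M c x / M ≡ c
code-quotient M c {x} x<M = begin
  (x + c * M) / M     ≡⟨ +-distrib-/-∣ʳ x (n∣m*n c) ⟩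
  x / M + c * M / M   ≡⟨ cong₂ _+_ (m<n⇒m/n≡0 x<M) (m*n/n≡m c M) ⟩
  c                   ∎
  where open ≡-Reasoning

code-injective : ∀ M .{{_ : NonZero M}} {c d x y} → x < M → y < M →
  code M c x ≡ code M d y → c ≡ d × x ≡ y
code-injective M {c} {d} x<M y<M e =
  trans (sym (code-quotient M c x<M)) (trans (cong (_/ M) e) (code-quotient M d y<M)) ,
  trans (sym (code-digit M c x<M)) (trans (cong (_% M) e) (code-digit M d y<M))

_≺_ : ℕ × ℕ → ℕ × ℕ → Set
(i' , j') ≺ (i , j) = j' < j ⊎ (j' ≡ j × i' < i)

≺⇒≢ : ∀ {p q} → p ≺ q → p ≢ q
≺⇒≢ (inj₁ j'<j)       refl = <-irrefl refl j'<j
≺⇒≢ (inj₂ (_ , i'<i)) refl = <-irrefl refl i'<i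

≺-trichotomy : ∀ p q → p ≺ q ⊎ p ≡ q ⊎ q ≺ p
≺-trichotomy (i , j) (i' , j') with <-cmp j j'
... | tri< j<j' _ _ = inj₁ (inj₁ j<j')
... | tri> _ _ j'<j = inj₂ (inj₂ (inj₁ j'<j))
... | tri≈ _ refl _ with <-cmp i i'
...   | tri< i<i' _ _ = inj₁ (inj₂ (refl , i<i'))
...   | tri≈ _ refl _ = inj₂ (inj₁ refl)
...   | tri> _ _ i'<i = inj₂ (inj₂ (inj₂ (refl , i'<i)))

stepwise-mono : (f : ℕ → ℕ) → (∀ n → f n ≤ f (suc n)) → ∀ {m n} → m ≤ n → f m ≤ f n
stepwise-mono f step {n = zero}  z≤n = ≤-refl
stepwise-mono f step {n = suc n} m≤1+n with m≤n⇒m<n∨m≡n m≤1+n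
... | inj₂ refl      = ≤-refl
... | inj₁ (s≤s m≤n) = ≤-trans (stepwise-mono f step m≤n) (step n)

module Rank (χ : Coloring) where

  HasColour : ℕ → ℕ × ℕ → Set
  HasColour c (i , j) = χ i j ≡ c

  column : ℕ → ℕ → ℕ → List (ℕ × ℕ)
  column c j zero = []
  column c j (suc i) with χ i j ≟ c
  ... | yes _ = (i , j) ∷ column c j i
  ... | no _  = column c j i

  below : ℕ → ℕ → List (ℕ × ℕ)
  below c zero    = []
  below c (suc j) = column c j j ++ below c j

  earlier : ℕ → ℕ → ℕ → List (ℕ × ℕ)
  earlier c i j = column c j i ++ below c j

  count : ℕ → ℕ → ℕ → ℕ
  count c i j = length (earlier c i j)

  rank : ℕ → ℕ → ℕ
  rank i j = count (χ i j) i j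

  InColumn : ℕ → ℕ → ℕ → ℕ × ℕ → Set
  InColumn c j i (i' , j') = i' < i × j' ≡ j × χ i' j' ≡ c

  InBelow : ℕ → ℕ → ℕ × ℕ → Set
  InBelow c j (i' , j') = i' < j' × j' < j × χ i' j' ≡ c

  column-widen : ∀ {c j i} p → InColumn c j i p → InColumn c j (suc i) p
  column-widen _ (i'<i , same-j , colour) = m<n⇒m<1+n i'<i , same-j , colour

  column-members : ∀ c j i → All (InColumn c j i) (column c j i)
  column-members c j zero = []
  column-members c j (suc i) with χ i j ≟ c
  ... | yes χij≡c = (n<1+n i , refl , χij≡c) ∷ All.map (column-widen _) (column-members c j i)
  ... | no _      = All.map (column-widen _) (column-members c j i)

  below-members : ∀ c j → All (InBelow c j) (below c j)
  below-members c zero    = []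
  below-members c (suc j) = All.++⁺ (All.map (from-column _) (column-members c j j))
                                    (All.map (widen _) (below-members c j))
    where
    from-column : ∀ p → InColumn c j j p → InBelow c (suc j) p
    from-column _ (i'<j , refl , colour) = i'<j , n<1+n j , colour
    widen : ∀ p → InBelow c j p → InBelow c (suc j) p
    widen _ (pair , j'<j , colour) = pair , m<n⇒m<1+n j'<j , colour

  column-unique : ∀ c j i → Unique (column c j i)
  column-unique c j zero = []
  column-unique c j (suc i) with χ i j ≟ c
  ... | yes _ = All.map new (column-members c j i) ∷ column-unique c j i
    where
    new : ∀ {p} → InColumn c j i p → (i , j) ≢ p
    new (i'<i , _ , _) eq = <-irrefl (sym (cong proj₁ eq)) i'<i
  ... | no _  = column-unique c j i

  column-below-disjoint : ∀ c j i {p} → ¬ (p ∈ column c j i × p ∈ below c j)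
  column-below-disjoint c j i (in-column , in-below)
    with All.lookup (column-members c j i) in-column | All.lookup (below-members c j) in-below
  ... | _ , refl , _ | _ , j<j , _ = <-irrefl refl j<j

  below-unique : ∀ c j → Unique (below c j)
  below-unique c zero    = []
  below-unique c (suc j) = Unique.++⁺ (column-unique c j j) (below-unique c j) (column-below-disjoint c j j)

  earlier-unique : ∀ c i j → Unique (earlier c i j)
  earlier-unique c i j = Unique.++⁺ (column-unique c j i) (below-unique c j) (column-below-disjoint c j i)

  Earlier : ℕ → ℕ → ℕ → ℕ × ℕ → Set
  Earlier c i j p = p ≺ (i , j) × IsPair p × HasColour c p

  earlier-members : ∀ c {i j} → i ≤ j → All (Earlier c i j) (earlier c i j)
  earlier-members c {i} {j} i≤j =
    All.++⁺ (All.map (from-column _) (column-members c j i)) (All.map (from-below _) (below-members c j))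
    where
    from-column : ∀ p → InColumn c j i p → Earlier c i j p
    from-column _ (i'<i , refl , colour) = inj₂ (refl , i'<i) , <-≤-trans i'<i i≤j , colour
    from-below : ∀ p → InBelow c j p → Earlier c i j p
    from-below _ (pair , j'<j , colour) = inj₁ j'<j , pair , colour

  -- In a k-bounded colouring every rank is below k: the pair itself together
  -- with the earlier pairs of its colour are rank + 1 distinct pairs of one colour.
  rank-bound : ∀ {k} → Bounded k χ → ∀ {i j} → i < j → rank i j < k
  rank-bound bounded {i} {j} i<j =
    bounded c ((i , j) ∷ earlier c i j)
      (All.map (λ e eq → ≺⇒≢ (proj₁ e) (sym eq)) members ∷ earlier-unique c i j)
      (i<j ∷ All.map (proj₁ ∘ proj₂) members)
      (refl ∷ All.map (proj₂ ∘ proj₂) members)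
    where
    c : ℕ
    c = χ i j
    members : All (Earlier c i j) (earlier c i j)
    members = earlier-members c (<⇒≤ i<j)

  column-step : ∀ c j i → length (column c j i) ≤ length (column c j (suc i))
  column-step c j i with χ i j ≟ c
  ... | yes _ = n≤1+n _
  ... | no _  = ≤-refl

  column-grows : ∀ {c i j} → χ i j ≡ c → length (column c j i) < length (column c j (suc i))
  column-grows {c} {i} {j} χij≡c with χ i j ≟ c
  ... | yes _    = n<1+n _
  ... | no χij≢c = contradiction χij≡c χij≢c

  column-strict : ∀ {c i i' j} → χ i j ≡ c → i < i' → length (column c j i) < length (column c j i')
  column-strict {c} {i} {i'} {j} χij≡c i<i' =
    <-≤-trans (column-grows χij≡c) (stepwise-mono (λ n → length (column c j n)) (column-step c j) i<i')

  below-mono : ∀ c {j j'} → j ≤ j' → length (below c j) ≤ length (below c j')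
  below-mono c = stepwise-mono (λ n → length (below c n)) step
    where
    step : ∀ j → length (below c j) ≤ length (below c (suc j))
    step j = ≤-trans (m≤n+m _ _) (≤-reflexive (sym (length-++ (column c j j))))

  count-split : ∀ c i j → count c i j ≡ length (column c j i) + length (below c j)
  count-split c i j = length-++ (column c j i)

  count-mono : ∀ {c i j i' j'} → χ i j ≡ c → i < j → (i , j) ≺ (i' , j') → count c i j < count c i' j'
  count-mono {c} {i} {j} {i'} {j'} χij≡c i<j (inj₁ j<j') = begin-strict
    count c i j                                   ≡⟨ count-split c i j ⟩
    length (column c j i) + length (below c j)    <⟨ +-monoˡ-< _ (column-strict χij≡c i<j) ⟩
    length (column c j j) + length (below c j)    ≡⟨ sym (length-++ (column c j j)) ⟩
    length (below c (suc j))                      ≤⟨ below-mono c j<j' ⟩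
    length (below c j')                           ≤⟨ m≤n+m _ _ ⟩
    length (column c j' i') + length (below c j') ≡⟨ sym (count-split c i' j') ⟩
    count c i' j'                                 ∎
    where open ≤-Reasoning
  count-mono {c} {i} {j} {i'} χij≡c _ (inj₂ (refl , i<i')) = begin-strict
    count c i j                                   ≡⟨ count-split c i j ⟩
    length (column c j i) + length (below c j)    <⟨ +-monoˡ-< _ (column-strict χij≡c i<i') ⟩
    length (column c j i') + length (below c j)   ≡⟨ sym (count-split c i' j) ⟩
    count c i' j                                  ∎
    where open ≤-Reasoning

  rank-mono : ∀ {i j i' j'} → i < j → χ i j ≡ χ i' j' → (i , j) ≺ (i' , j') → rank i j < rank i' j'
  rank-mono {i} {j} {i'} {j'} i<j same-colour p≺q =
    subst (λ c → count c i j < rank i' j') (sym same-colour) (count-mono same-colour i<j p≺q)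

  rank-injective : ∀ {i j i' j'} → i < j → i' < j' → χ i j ≡ χ i' j' → rank i j ≡ rank i' j' →
    (i , j) ≡ (i' , j')
  rank-injective {i} {j} {i'} {j'} i<j i'<j' same-colour same-rank with ≺-trichotomy (i , j) (i' , j')
  ... | inj₁ p≺q        = contradiction same-rank (<⇒≢ (rank-mono i<j same-colour p≺q))
  ... | inj₂ (inj₁ p≡q) = p≡q
  ... | inj₂ (inj₂ q≺p) = contradiction (sym same-rank) (<⇒≢ (rank-mono i'<j' (sym same-colour) q≺p))

collapse : ℕ → ℕ → ℕ → ℕ
collapse a b n with n ≟ a | n ≟ b
... | no _ | no _ = suc n
... | _    | _    = 0

collapse-bound : ∀ a b {n k} → n < k → collapse a b n < suc k
collapse-bound a b {n} n<k with n ≟ a | n ≟ b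
... | no _  | no _  = s≤s n<k
... | yes _ | _     = s≤s z≤n
... | no _  | yes _ = s≤s z≤n

collapse-left : ∀ a b → collapse a b a ≡ 0
collapse-left a b with a ≟ a | a ≟ b
... | yes _   | _ = refl
... | no a≢a  | _ = contradiction refl a≢a

collapse-right : ∀ a b → collapse a b b ≡ 0
collapse-right a b with b ≟ a | b ≟ b
... | _     | no b≢b = contradiction refl b≢b
... | yes _ | yes _  = refl
... | no _  | yes _  = refl

matches : ℕ → ℕ → Bool
matches a n with n ≟ a
... | yes _ = true
... | no _  = false

collapse-injective : ∀ a b {n m} → matches a n ≡ matches a m → collapse a b n ≡ collapse a b m → n ≡ m
collapse-injective a b {n} {m} same-tag same-value with n ≟ a | n ≟ b | m ≟ a | m ≟ b
... | yes n≡a | _       | yes m≡a | _       = trans n≡a (sym m≡a)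
... | no _    | yes n≡b | no _    | yes m≡b = trans n≡b (sym m≡b)
... | no _    | no _    | no _    | no _    = suc-injective same-value
... | yes _   | _       | no _    | _       = contradiction same-tag λ ()
... | no _    | _       | yes _   | _       = contradiction same-tag λ ()
... | no _    | yes _   | no _    | no _    = contradiction same-value λ ()
... | no _    | no _    | no _    | yes _   = contradiction same-value λ ()

module Collapsed (χ : Coloring) (k : ℕ) (bounded : Bounded k χ) where
  open Rank χ

  χ[_,_] : ℕ → ℕ → Coloring
  χ[ a , b ] i j = code (suc k) (χ i j) (collapse a b (rank i j))

  χ[,]-2-bounded : ∀ a b → Bounded 2 χ[ a , b ]
  χ[,]-2-bounded a b = tagged⇒2-bounded χ[ a , b ] (λ i j → matches a (rank i j)) separates
    where
    separates : ∀ i j i' j' → i < j → i' < j' → χ[ a , b ] i j ≡ χ[ a , b ] i' j' →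
      matches a (rank i j) ≡ matches a (rank i' j') → (i , j) ≡ (i' , j')
    separates i j i' j' i<j i'<j' same-code same-tag
      with code-injective (suc k) (collapse-bound a b (rank-bound bounded i<j))
                                  (collapse-bound a b (rank-bound bounded i'<j')) same-code
    ... | same-colour , same-collapse =
      rank-injective i<j i'<j' same-colour (collapse-injective a b same-tag same-collapse)

  χ[,]-merges : ∀ {i j i' j'} → χ i j ≡ χ i' j' →
    χ[ rank i j , rank i' j' ] i j ≡ χ[ rank i j , rank i' j' ] i' j'
  χ[,]-merges {i} {j} {i'} {j'} same-colour = cong₂ (code (suc k)) same-colour
    (trans (collapse-left (rank i j) (rank i' j')) (sym (collapse-right (rank i j) (rank i' j'))))

mainTheorem14 : (𝒱 : Subset → Set) → RainbowRamsey 𝒱 → (k : ℕ) → (χ : Coloring) →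
    Bounded k χ → Σ Subset (λ A → 𝒱 A × Polychromatic χ A)
mainTheorem14 𝒱 rainbowRamsey k χ bounded = A , A∈𝒱 , A-polychromatic
  where
  open RainbowRamsey rainbowRamsey
  open Rank χ
  open Collapsed χ k bounded

  witness : ∀ a b → Σ Subset (λ B → 𝒱 B × Polychromatic χ[ a , b ] B)
  witness a b = rainbow χ[ a , b ] (χ[,]-2-bounded a b)

  B : ℕ → ℕ → Subset
  B a b = proj₁ (witness a b)

  A : Subset
  A = ⋂< (λ a → ⋂< (B a) k) k

  A∈𝒱 : 𝒱 A
  A∈𝒱 = ⋂<-∈ ultrafilter _ k λ a _ → ⋂<-∈ ultrafilter (B a) k λ b _ → proj₁ (proj₂ (witness a b))

  A-polychromatic : Polychromatic χ A
  A-polychromatic i j i' j' Ai Aj Ai' Aj' i<j i'<j' same-colour =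
    proj₂ (proj₂ (witness a b)) i j i' j' (in-B Ai) (in-B Aj) (in-B Ai') (in-B Aj') i<j i'<j'
      (χ[,]-merges same-colour)
    where
    a = rank i j
    b = rank i' j'
    in-B : ∀ {x} → A x → B a b x
    in-B Ax = Ax a (rank-bound bounded i<j) b (rank-bound bounded i'<j')
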